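{- Let $D$ be a positive, odd, squarefree integer with prime divisors $p_1<\dots<p_{\omega(D)}$, and let $u,v$ be integers coprime with $D$. Let \[ \mathcal{E}_D(u,v)=\#\{(a,b)\in\mathbb{N}^2\colon D=ab,\ ua\equiv\square\pmod b,\ vb\equiv\square\pmod a\}. \] Then $\mathcal{E}_D(u,v)$ equals the cardinality of the affine subspace $\mathcal{F}_D(u,v)$ of $\mathbb{F}_2^{\omega(D)}$ consisting of the $(x_1,\dots,x_{\omega(D)})$ satisfying \[ \Bigl(\beta_u(p_i)+\beta_v(p_i)+\sum_{j\neq i}\alpha(p_j,p_i)\Bigr)x_i+\sum_{j\neq i}\alpha(p_j,p_i)x_j=\beta_u(p_i)\qquad\text{for all } i\in\{1,\dots,\omega(D)\}. \]
   Context: $x\equiv\square\pmod y$ means that $x$ is congruent to the square of an integer modulo $y$ (automatically true for $y=1$). For a prime $p\nmid D$... more precisely, for an odd prime $p$ and an integer $w$ coprime with $p$, $\beta_w(p)\in\mathbb{F}_2$ is defined by $\left(\frac{w}{p}\right)=(-1)^{\beta_w(p)}$ (Legendre symbol), and for distinct odd primes $p,q$, $\alpha(q,p)\in\mathbb{F}_2$ is defined by $\left(\frac{q}{p}\right)=(-1)^{\alpha(q,p)}$. $\omega(D)$ is the number of prime divisors of $D$. -}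

module Defs where

open import Data.Bool using (Bool; true; false; not; _∧_; _xor_; if_then_else_)
open import Data.Nat using (ℕ; zero; suc; _*_; _≡ᵇ_)
open import Data.Integer using (ℤ; +_; _-_; _%ℕ_)
import Data.Integer as ℤ
open import Data.Fin using (Fin; toℕ)
open import Data.List using (List; []; _∷_; upTo; map; concatMap; foldr; allFin)
open import Data.Bool.ListAction using (any; all)
open import Data.Vec using (Vec; lookup)
import Data.Vec as Vec
open import Data.Product using (_×_; _,_)

-- x ≡ □ (mod y): some residue z ∈ {0,…,y-1} has y ∣ x - z².
-- (Only used for y ≥ 1; for y = 0 we put false, which never occurs below.)
sqModᵇ : ℤ → ℕ → Bool
sqModᵇ x zero = false
sqModᵇ x (suc k) =
  any (λ z → ((x - (+ z) ℤ.* (+ z)) %ℕ suc k) ≡ᵇ 0) (upTo (suc k))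

-- β_w(p) : (w/p) = (-1)^β_w(p); for p an odd prime with p ∤ w, (w/p) = 1 iff w is a square mod p.
β : ℤ → ℕ → Bool
β w p = not (sqModᵇ w p)

α : ℕ → ℕ → Bool
α q p = β (+ q) p

countᵇ : {A : Set} → (A → Bool) → List A → ℕ
countᵇ P [] = 0
countᵇ P (x ∷ xs) = if P x then suc (countᵇ P xs) else countᵇ P xs

range1 : ℕ → List ℕ
range1 n = map suc (upTo n)

-- all pairs (a,b) with 1 ≤ a,b ≤ D (every pair with D = ab, D ≥ 1, lies here)
pairsUpTo : ℕ → List (ℕ × ℕ)
pairsUpTo D = concatMap (λ a → map (λ b → (a , b)) (range1 D)) (range1 D)

𝓔 : ℕ → ℤ → ℤ → ℕ
𝓔 D u v = countᵇ (λ { (a , b) → ((a * b) ≡ᵇ D) ∧ (sqModᵇ (u ℤ.* (+ a)) b ∧ sqModᵇ (v ℤ.* (+ b)) a) })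
                 (pairsUpTo D)

-- all vectors of 𝔽₂ⁿ (𝔽₂ = Bool with xor as addition and ∧ as multiplication)
allVecs : (n : ℕ) → List (Vec Bool n)
allVecs zero = Vec.[] ∷ []
allVecs (suc n) = concatMap (λ xs → (false Vec.∷ xs) ∷ (true Vec.∷ xs) ∷ []) (allVecs n)

_≡ᶠᵇ_ : {n : ℕ} → Fin n → Fin n → Bool
i ≡ᶠᵇ j = toℕ i ≡ᵇ toℕ j

sumExcept : {n : ℕ} → Fin n → (Fin n → Bool) → Bool
sumExcept {n} i f = foldr (λ j acc → (if j ≡ᶠᵇ i then false else f j) xor acc) false (allFin n)

-- membership in 𝓕_D(u,v), where p : Fin ω → ℕ lists the prime divisors of D
in𝓕ᵇ : {ω : ℕ} → (p : Fin ω → ℕ) → ℤ → ℤ → Vec Bool ω → Bool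
in𝓕ᵇ {ω} p u v x = all eqn (allFin ω)
  where
  eqn : Fin ω → Bool
  eqn i = not ( ( ((β u (p i) xor β v (p i)) xor sumExcept i (λ j → α (p j) (p i))) ∧ lookup x i
                  xor sumExcept i (λ j → α (p j) (p i) ∧ lookup x j) )
                xor β u (p i) )

#𝓕 : {ω : ℕ} → (p : Fin ω → ℕ) → ℤ → ℤ → ℕ
#𝓕 {ω} p u v = countᵇ (in𝓕ᵇ p u v) (allVecs ω)

module Submission where

-- Let p₀ < … < p_{ω-1} be the primes of the squarefree odd D.  A vector
-- x ∈ 𝔽₂^ω encodes the divisor Ψ x = ∏_{x_j = 1} p_j, and x ↦ (Ψ x, Ψ x̄) (x̄ the
-- complement of x) is a bijection from 𝔽₂^ω onto the factorisations D = a·b.  By the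
-- Chinese remainder theorem u·a is a square modulo b iff it is one modulo every p_i with
-- x_i = 0; as a is a product of the p_j with x_j = 1 and the Legendre symbol is
-- multiplicative, β_{u·a}(p_i) = β_u(p_i) + Σ_{j ≠ i} α(p_j,p_i) x_j, so this local
-- condition is exactly the i-th equation of 𝓕_D(u,v) when x_i = 0 (for x_i = 1 the same
-- holds with v and b).  Hence both counts count the same set.

open import Defs
import Algebra.Properties.CommutativeSemigroup as CommutativeSemigroup
open import Data.Bool using (Bool; true; false; not; T; _xor_; _∧_; if_then_else_)
open import Data.Bool.Properties using (T?; T-∧; T-≡; not-involutive; ∧-identityʳ; ∧-zeroʳ; xor-identityʳ; xor-assoc)
open import Data.Bool.Solver using (module xor-∧-Solver)
open import Data.Empty using (⊥; ⊥-elim)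
open import Data.Fin using (Fin; toℕ)
import Data.Fin as Fin
import Data.Fin.Properties as Finₚ
open import Data.Integer using (ℤ; +_; -_; _+_; _-_; _%ℕ_; _/ℕ_; ∣_∣) renaming (_*_ to _·_)
import Data.Integer.Properties as ℤ
open import Data.Integer.DivMod using (a≡a%ℕn+[a/ℕn]*n; n%ℕd<d)
open import Data.Integer.Divisibility.Signed as ℤ∣ using (divides; ∣ᵤ⇒∣; ∣⇒∣ᵤ) renaming (_∣_ to _∣ᶻ_)
open import Data.Integer.Tactic.RingSolver using (solve-∀)
open import Data.List using (List; []; _∷_; _++_; map; length; filter; foldr; upTo; allFin; concatMap; cartesianProduct)
open import Data.List.Membership.Propositional using (_∈_; _∉_; lose)
open import Data.List.Membership.Propositional.Properties
  using (∈-filter⁺; ∈-filter⁻; ∈-map⁺; ∈-map⁻; ∈-upTo⁺; ∈-upTo⁻; ∈-cartesianProduct⁺; ∈-allFin)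
open import Data.List.Properties using (length-removeAt′; length-map; length-upTo)
open import Data.List.Relation.Unary.All using (All; []; _∷_)
import Data.List.Relation.Unary.All as All
open import Data.List.Relation.Unary.All.Properties using (all⁺; all⁻)
open import Data.List.Relation.Unary.AllPairs using ([]; _∷_)
open import Data.List.Relation.Unary.Any using (here; there; index; satisfied; _─_)
open import Data.List.Relation.Unary.Any.Properties using (any⁺; any⁻)
open import Data.List.Relation.Unary.Unique.Propositional using (Unique)
import Data.List.Relation.Unary.Unique.Propositional.Properties as Unique
open import Data.Nat using (ℕ; zero; suc; NonZero; _*_; _<_; _≤_; _≡ᵇ_; z≤n; s≤s)
import Data.Nat as ℕ
import Data.Nat.Properties as ℕ
open import Data.Nat.Properties using (≤-antisym; +-suc; suc-injective; module ≤-Reasoning)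
open import Data.Nat.Coprimality using (Coprime; coprime-Bézout; coprime-divisor; 1-coprimeTo)
open import Data.Nat.Divisibility using (_∣_; _∣?_)
import Data.Nat.Divisibility as ℕ
open import Data.Nat.GCD using (module Bézout)
open import Data.Nat.ListAction using (product)
open import Data.Nat.Primality using (Prime; euclidsLemma; prime⇒irreducible; prime⇒nonZero; ¬prime[1])
open import Data.Nat.Primality.Factorisation using (factorise; PrimeFactorisation)
open import Data.Product using (Σ; ∃; _×_; _,_; proj₁; proj₂)
open import Data.Sum as Sum using (_⊎_; inj₁; inj₂)
open import Data.Vec as Vec using (Vec; lookup; tabulate)
import Data.Vec.Properties as Vec
open import Function using (_∘_; id; Equivalence)
open import Level using (0ℓ)
open import Relation.Binary.Bundles using (Setoid)
open import Relation.Binary.Definitions using (tri<; tri≈; tri>)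
import Relation.Binary.Reasoning.Setoid as SetoidReasoning
open import Relation.Nullary using (¬_; isYes)
open import Relation.Nullary.Decidable using (toWitness; fromWitness)
open import Relation.Binary.PropositionalEquality
  using (_≡_; _≢_; refl; sym; trans; cong; cong₂; subst; module ≡-Reasoning)

ℕ-interchange : ∀ a b c d → (a * b) * (c * d) ≡ (a * c) * (b * d)
ℕ-interchange = CommutativeSemigroup.interchange ℕ.*-commutativeSemigroup

∈-─⁺ : ∀ {A : Set} {w x : A} {ys : List A} (x∈ys : x ∈ ys) → w ∈ ys → w ≢ x → w ∈ (ys ─ x∈ys)
∈-─⁺ (here refl) (here refl) w≢x = ⊥-elim (w≢x refl)
∈-─⁺ (here refl) (there w∈ys) _ = w∈ys
∈-─⁺ (there x∈ys) (here refl) _ = here refl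
∈-─⁺ (there x∈ys) (there w∈ys) w≢x = there (∈-─⁺ x∈ys w∈ys w≢x)

injection-length : ∀ {A B : Set} (f : A → B) {xs : List A} {ys : List B} → Unique xs
                 → (∀ {a b} → a ∈ xs → b ∈ xs → f a ≡ f b → a ≡ b)
                 → (∀ {a} → a ∈ xs → f a ∈ ys)
                 → length xs ≤ length ys
injection-length f {[]} _ _ _ = z≤n
injection-length f {x ∷ xs} {ys} (x∉xs ∷ unique) injective into = begin
  suc (length xs)           ≤⟨ s≤s (injection-length f unique (λ a b → injective (there a) (there b)) into-rest) ⟩
  suc (length (ys ─ fx∈ys)) ≡⟨ sym (length-removeAt′ ys (index fx∈ys)) ⟩
  length ys                 ∎
  where
  open ≤-Reasoning
  fx∈ys = into (here refl)
  into-rest : ∀ {a} → a ∈ xs → f a ∈ (ys ─ fx∈ys)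
  into-rest a∈xs = ∈-─⁺ fx∈ys (into (there a∈xs))
    (λ fa≡fx → All.lookup x∉xs a∈xs (sym (injective (there a∈xs) (here refl) fa≡fx)))

module _ {A : Set} where

  filterᵇ : (A → Bool) → List A → List A
  filterᵇ P = filter (T? ∘ P)

  countᵇ≡length-filter : (P : A → Bool) (xs : List A) → countᵇ P xs ≡ length (filterᵇ P xs)
  countᵇ≡length-filter P [] = refl
  countᵇ≡length-filter P (x ∷ xs) with P x
  ... | true = cong suc (countᵇ≡length-filter P xs)
  ... | false = countᵇ≡length-filter P xs

  countᵇ-unique : (P : A → Bool) {xs ys : List A} → Unique xs → Unique ys
                → (∀ {z} → z ∈ xs → T (P z) → z ∈ ys)
                → (∀ {z} → z ∈ ys → T (P z) → z ∈ xs)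
                → countᵇ P xs ≡ countᵇ P ys
  countᵇ-unique P {xs} {ys} unique-xs unique-ys xs⊆ys ys⊆xs = begin
    countᵇ P xs               ≡⟨ countᵇ≡length-filter P xs ⟩
    length (filterᵇ P xs)     ≡⟨ ≤-antisym (included unique-xs xs⊆ys) (included unique-ys ys⊆xs) ⟩
    length (filterᵇ P ys)     ≡⟨ sym (countᵇ≡length-filter P ys) ⟩
    countᵇ P ys               ∎
    where
    open ≡-Reasoning
    included : ∀ {us vs} → Unique us → (∀ {z} → z ∈ us → T (P z) → z ∈ vs)
             → length (filterᵇ P us) ≤ length (filterᵇ P vs)
    included unique us⊆vs = injection-length id (Unique.filter⁺ (T? ∘ P) unique) (λ _ _ e → e)
      (λ z∈ → let (z∈us , Pz) = ∈-filter⁻ (T? ∘ P) z∈ in ∈-filter⁺ (T? ∘ P) (us⊆vs z∈us Pz) Pz)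

  length-filter-split : (P : A → Bool) (xs : List A)
                      → length (filterᵇ P xs) ℕ.+ length (filterᵇ (not ∘ P) xs) ≡ length xs
  length-filter-split P [] = refl
  length-filter-split P (x ∷ xs) with P x
  ... | true = cong suc (length-filter-split P xs)
  ... | false = trans (+-suc _ _) (cong suc (length-filter-split P xs))

  countᵇ-map : {B : Set} (f : B → A) (P : A → Bool) (xs : List B) → countᵇ P (map f xs) ≡ countᵇ (P ∘ f) xs
  countᵇ-map f P [] = refl
  countᵇ-map f P (x ∷ xs) with P (f x)
  ... | true = cong suc (countᵇ-map f P xs)
  ... | false = countᵇ-map f P xs

  countᵇ-cong : {P Q : A → Bool} → (∀ x → P x ≡ Q x) → (xs : List A) → countᵇ P xs ≡ countᵇ Q xs
  countᵇ-cong P≗Q [] = refl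
  countᵇ-cong {P} {Q} P≗Q (x ∷ xs) rewrite P≗Q x = cong (λ n → if Q x then suc n else n) (countᵇ-cong P≗Q xs)

T-ext : ∀ {a b} → (T a → T b) → (T b → T a) → a ≡ b
T-ext {true} {true} _ _ = refl
T-ext {true} {false} a⇒b _ = ⊥-elim (a⇒b _)
T-ext {false} {true} _ b⇒a = ⊥-elim (b⇒a _)
T-ext {false} {false} _ _ = refl

false-or-true : ∀ b → b ≡ false ⊎ b ≡ true
false-or-true false = inj₁ refl
false-or-true true = inj₂ refl

not-injective : ∀ {b} → not b ≡ true → b ≡ false
not-injective {false} _ = refl

T-not : ∀ {b} → ¬ T b → T (not b)
T-not {true} ¬t = ¬t _
T-not {false} _ = _

≡ᶠᵇ⇒≡ : ∀ {n} {i j : Fin n} → (j ≡ᶠᵇ i) ≡ true → j ≡ i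
≡ᶠᵇ⇒≡ {i = i} {j} e = Finₚ.toℕ-injective (ℕ.≡ᵇ⇒≡ (toℕ j) (toℕ i) (subst T (sym e) _))

∈-range1 : ∀ {n r} → 1 ≤ r → r ≤ n → r ∈ range1 n
∈-range1 {r = suc r} _ r<n = ∈-map⁺ suc (∈-upTo⁺ r<n)

range1-bounds : ∀ {n r} → r ∈ range1 n → 1 ≤ r × r ≤ n
range1-bounds r∈ with ∈-map⁻ suc r∈
... | _ , k∈ , refl = s≤s z≤n , ∈-upTo⁻ k∈

range1-unique : ∀ n → Unique (range1 n)
range1-unique n = Unique.map⁺ suc-injective (Unique.upTo⁺ n)

length-range1 : ∀ n → length (range1 n) ≡ n
length-range1 n = trans (length-map suc (upTo n)) (length-upTo n)

∈-allVecs : ∀ {n} (x : Vec Bool n) → x ∈ allVecs n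
∈-allVecs Vec.[] = here refl
∈-allVecs (b Vec.∷ x) = extend b (∈-allVecs x)
  where
  extend : ∀ {n} {L : List (Vec Bool n)} {x} b → x ∈ L → (b Vec.∷ x) ∈ concatMap (λ xs → (false Vec.∷ xs) ∷ (true Vec.∷ xs) ∷ []) L
  extend false (here refl) = here refl
  extend true (here refl) = there (here refl)
  extend b (there x∈L) = there (there (extend b x∈L))

allVecs-unique : ∀ n → Unique (allVecs n)
allVecs-unique zero = All.[] ∷ []
allVecs-unique (suc n) = extend (allVecs-unique n)
  where
  extensions : List (Vec Bool n) → List (Vec Bool (suc n))
  extensions = concatMap (λ xs → (false Vec.∷ xs) ∷ (true Vec.∷ xs) ∷ [])
  tail∈ : ∀ {L w} → w ∈ extensions L → Vec.tail w ∈ L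
  tail∈ {_ ∷ L} (here refl) = here refl
  tail∈ {_ ∷ L} (there (here refl)) = here refl
  tail∈ {_ ∷ L} (there (there w∈)) = there (tail∈ w∈)
  fresh : ∀ {L x} b → All.All (x ≢_) L → All.All ((b Vec.∷ x) ≢_) (extensions L)
  fresh {L} b x∉L = All.tabulate (λ w∈ x∷≡w → All.lookup x∉L (tail∈ w∈) (cong Vec.tail x∷≡w))
  extend : ∀ {L} → Unique L → Unique (extensions L)
  extend {[]} [] = []
  extend {x ∷ L} (x∉L ∷ unique) = ((λ ()) All.∷ fresh false x∉L) ∷ fresh true x∉L ∷ extend unique

pairsUpTo≡cartesianProduct : ∀ D → pairsUpTo D ≡ cartesianProduct (range1 D) (range1 D)
pairsUpTo≡cartesianProduct D = go (range1 D)
  where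
  go : ∀ as → concatMap (λ a → map (λ b → (a , b)) (range1 D)) as ≡ cartesianProduct as (range1 D)
  go [] = refl
  go (a ∷ as) = cong (map (λ b → (a , b)) (range1 D) ++_) (go as)

pairsUpTo-unique : ∀ D → Unique (pairsUpTo D)
pairsUpTo-unique D = subst Unique (sym (pairsUpTo≡cartesianProduct D)) (Unique.cartesianProduct⁺ (range1-unique D) (range1-unique D))

∈-pairsUpTo : ∀ {D a b} → 1 ≤ a → a ≤ D → 1 ≤ b → b ≤ D → (a , b) ∈ pairsUpTo D
∈-pairsUpTo {D} 1≤a a≤D 1≤b b≤D = subst ((_ , _) ∈_) (sym (pairsUpTo≡cartesianProduct D))
  (∈-cartesianProduct⁺ (∈-range1 1≤a a≤D) (∈-range1 1≤b b≤D))

infix 4 _≡_mod_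
record _≡_mod_ (x y : ℤ) (m : ℕ) : Set where
  constructor congruent
  field divides-difference : + m ∣ᶻ x - y
open _≡_mod_ public

∣0 : ∀ k → k ∣ᶻ + 0
∣0 k = divides (+ 0) (sym (ℤ.*-zeroˡ k))

≡-reflexive : ∀ {m x y} → x ≡ y → x ≡ y mod m
≡-reflexive {m} {x} refl = congruent (subst (+ m ∣ᶻ_) (sym (ℤ.+-inverseʳ x)) (∣0 (+ m)))

≡-refl : ∀ {m} x → x ≡ x mod m
≡-refl x = ≡-reflexive refl

≡-sym : ∀ {m x y} → x ≡ y mod m → y ≡ x mod m
≡-sym {m} {x} {y} (congruent d) = congruent (subst (+ m ∣ᶻ_) (negate x y) (ℤ∣.∣m⇒∣-m d))
  where negate : ∀ x y → - (x - y) ≡ y - x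
        negate = solve-∀

≡-trans : ∀ {m x y z} → x ≡ y mod m → y ≡ z mod m → x ≡ z mod m
≡-trans {m} {x} {y} {z} (congruent d) (congruent e) = congruent (subst (+ m ∣ᶻ_) (telescope x y z) (ℤ∣.∣m∣n⇒∣m+n d e))
  where telescope : ∀ x y z → (x - y) + (y - z) ≡ x - z
        telescope = solve-∀

+-cong : ∀ {m x x′ y y′} → x ≡ x′ mod m → y ≡ y′ mod m → x + y ≡ x′ + y′ mod m
+-cong {m} {x} {x′} {y} {y′} (congruent d) (congruent e) = congruent (subst (+ m ∣ᶻ_) (regroup x x′ y y′) (ℤ∣.∣m∣n⇒∣m+n d e))
  where regroup : ∀ x x′ y y′ → (x - x′) + (y - y′) ≡ (x + y) - (x′ + y′)
        regroup = solve-∀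

·-cong : ∀ {m x x′ y y′} → x ≡ x′ mod m → y ≡ y′ mod m → x · y ≡ x′ · y′ mod m
·-cong {m} {x} {x′} {y} {y′} (congruent d) (congruent e) =
  congruent (subst (+ m ∣ᶻ_) (regroup x x′ y y′) (ℤ∣.∣m∣n⇒∣m+n (ℤ∣.∣n⇒∣m*n x e) (ℤ∣.∣m⇒∣m*n y′ d)))
  where regroup : ∀ x x′ y y′ → x · (y - y′) + (x - x′) · y′ ≡ x · y - x′ · y′
        regroup = solve-∀

≡-mod-setoid : ℕ → Setoid 0ℓ 0ℓ
≡-mod-setoid m = record
  { Carrier = ℤ
  ; _≈_ = λ x y → x ≡ y mod m
  ; isEquivalence = record { refl = ≡-refl _ ; sym = ≡-sym ; trans = ≡-trans }
  }

module ≡-mod-Reasoning (m : ℕ) = SetoidReasoning (≡-mod-setoid m)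

≡-mod-∣ : ∀ {m k x y} → k ∣ m → x ≡ y mod m → x ≡ y mod k
≡-mod-∣ k∣m (congruent d) = congruent (ℤ∣.∣-trans (∣ᵤ⇒∣ k∣m) d)

≡0⇒∣ : ∀ {m x} → x ≡ + 0 mod m → + m ∣ᶻ x
≡0⇒∣ {m} {x} (congruent d) = subst (+ m ∣ᶻ_) (ℤ.+-identityʳ x) d

∣⇒≡0 : ∀ {m x} → + m ∣ᶻ x → x ≡ + 0 mod m
∣⇒≡0 {m} {x} d = congruent (subst (+ m ∣ᶻ_) (sym (ℤ.+-identityʳ x)) d)

≡-%ℕ : ∀ x n .{{_ : NonZero n}} → x ≡ + (x %ℕ n) mod n
≡-%ℕ x n = congruent (divides (x /ℕ n) (cancel {x %ℕ n} {x /ℕ n} (a≡a%ℕn+[a/ℕn]*n x n)))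
  where
  cancel : ∀ {r q} → x ≡ + r + q · + n → x - + r ≡ q · + n
  cancel {r} {q} refl = regroup (+ r) q (+ n)
    where regroup : ∀ r q n → (r + q · n) - r ≡ q · n
          regroup = solve-∀

∣-<⇒≡0 : ∀ {n r} → n ∣ r → r < n → r ≡ 0
∣-<⇒≡0 {r = zero} _ _ = refl
∣-<⇒≡0 {r = suc r} n∣r r<n = ⊥-elim (ℕ.>⇒∤ r<n n∣r)

∣⇒%ℕ≡0 : ∀ x n .{{_ : NonZero n}} → + n ∣ᶻ x → x %ℕ n ≡ 0
∣⇒%ℕ≡0 x n n∣x = ∣-<⇒≡0 (∣⇒∣ᵤ (≡0⇒∣ (≡-trans (≡-sym (≡-%ℕ x n)) (∣⇒≡0 n∣x)))) (n%ℕd<d x n)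

lift-identity : ∀ {a b c d e} → a ℕ.+ b * c ≡ d * e → + a + + b · + c ≡ + d · + e
lift-identity {a} {b} {c} {d} {e} eq = begin
  + a + + b · + c   ≡⟨ cong (λ w → + a + w) (ℤ.pos-* b c) ⟨
  + a + + (b * c) ≡⟨ ℤ.pos-+ a (b * c) ⟨
  + (a ℕ.+ b * c) ≡⟨ cong +_ eq ⟩
  + (d * e)       ≡⟨ ℤ.pos-* d e ⟩
  + d · + e         ∎
  where open ≡-Reasoning

invertible : ∀ {m n} → Coprime m n → Σ ℤ λ t → t · + n ≡ + 1 mod m
invertible {m} {n} coprime with coprime-Bézout coprime
... | Bézout.+- x y eq =
  - + y , congruent (divides (- + x) (trans (rearrange (+ y) (+ n)) (trans (cong -_ (lift-identity {1} {y} {n} {x} {m} eq)) (negate (+ x) (+ m)))))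
  where
  rearrange : ∀ y n → - y · n - + 1 ≡ - (+ 1 + y · n)
  rearrange = solve-∀
  negate : ∀ x m → - (x · m) ≡ - x · m
  negate = solve-∀
... | Bézout.-+ x y eq =
  + y , congruent (divides (+ x) (trans (cong (_- + 1) (sym (lift-identity {1} {x} {m} {y} {n} eq))) (cancel (+ x) (+ m))))
  where
  cancel : ∀ x m → (+ 1 + x · m) - + 1 ≡ x · m
  cancel = solve-∀

crt : ∀ {m n} → Coprime m n → ∀ a b → Σ ℤ λ z → z ≡ a mod m × z ≡ b mod n
crt {m} {n} coprime a b with invertible coprime
... | t , tn≡1 = b + (a - b) · (t · + n) , glue-m , glue-n
  where
  tn≡0 : t · + n ≡ + 0 mod n
  tn≡0 = ∣⇒≡0 (ℤ∣.∣n⇒∣m*n t ℤ∣.∣-refl)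
  glue-m : b + (a - b) · (t · + n) ≡ a mod m
  glue-m = begin
    b + (a - b) · (t · + n) ≈⟨ +-cong (≡-refl b) (·-cong (≡-refl (a - b)) tn≡1) ⟩
    b + (a - b) · + 1       ≡⟨ simplify a b ⟩
    a                       ∎
    where
    open ≡-mod-Reasoning m
    simplify : ∀ a b → b + (a - b) · + 1 ≡ a
    simplify = solve-∀
  glue-n : b + (a - b) · (t · + n) ≡ b mod n
  glue-n = begin
    b + (a - b) · (t · + n) ≈⟨ +-cong (≡-refl b) (·-cong (≡-refl (a - b)) tn≡0) ⟩
    b + (a - b) · + 0       ≡⟨ simplify a b ⟩
    b                       ∎
    where
    open ≡-mod-Reasoning n
    simplify : ∀ a b → b + (a - b) · + 0 ≡ b
    simplify = solve-∀

coprime-∣-* : ∀ {m n k} → Coprime m n → m ∣ k → n ∣ k → m * n ∣ k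
coprime-∣-* {m} {n} coprime m∣k (ℕ.divides q refl) =
  ℕ.*-monoˡ-∣ n (coprime-divisor coprime (subst (m ∣_) (ℕ.*-comm q n) m∣k))

≡-mod-* : ∀ {m n x y} → Coprime m n → x ≡ y mod m → x ≡ y mod n → x ≡ y mod m * n
≡-mod-* coprime (congruent m∣) (congruent n∣) = congruent (∣ᵤ⇒∣ (coprime-∣-* coprime (∣⇒∣ᵤ m∣) (∣⇒∣ᵤ n∣)))

SquareMod : ℤ → ℕ → Set
SquareMod w m = Σ ℤ λ z → w ≡ z · z mod m

square-resp : ∀ {m x y} → x ≡ y mod m → SquareMod x m → SquareMod y m
square-resp x≡y (z , x≡z²) = z , ≡-trans (≡-sym x≡y) x≡z²

square-· : ∀ {m x y} → SquareMod x m → SquareMod y m → SquareMod (x · y) m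
square-· (z , x≡z²) (z′ , y≡z′²) = z · z′ , ≡-trans (·-cong x≡z² y≡z′²) (≡-reflexive (regroup z z′))
  where regroup : ∀ z z′ → (z · z) · (z′ · z′) ≡ (z · z′) · (z · z′)
        regroup = solve-∀

square-mod-∣ : ∀ {m k w} → k ∣ m → SquareMod w m → SquareMod w k
square-mod-∣ k∣m (z , w≡z²) = z , ≡-mod-∣ k∣m w≡z²

square-mod-1 : ∀ w → SquareMod w 1
square-mod-1 w = + 0 , congruent (ℤ∣.∣ᵤ⇒∣ (ℕ.1∣ _))

square-mod-* : ∀ {m n w} → Coprime m n → SquareMod w m → SquareMod w n → SquareMod w (m * n)
square-mod-* {m} {n} {w} coprime (z₁ , w≡z₁²) (z₂ , w≡z₂²) = z , ≡-mod-* coprime w≡z²[mod-m] w≡z²[mod-n]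
  where
  glued = crt coprime z₁ z₂
  z = proj₁ glued
  w≡z²[mod-m] : w ≡ z · z mod m
  w≡z²[mod-m] = ≡-trans w≡z₁² (·-cong (≡-sym (proj₁ (proj₂ glued))) (≡-sym (proj₁ (proj₂ glued))))
  w≡z²[mod-n] : w ≡ z · z mod n
  w≡z²[mod-n] = ≡-trans w≡z₂² (·-cong (≡-sym (proj₂ (proj₂ glued))) (≡-sym (proj₂ (proj₂ glued))))

sqModᵇ-sound : ∀ w {m} → 1 ≤ m → T (sqModᵇ w m) → SquareMod w m
sqModᵇ-sound w {suc k} _ found with satisfied (any⁻ _ (upTo (suc k)) found)
... | z , remainder≡0 =
  + z , congruent (≡0⇒∣ (subst (λ r → w - + z · + z ≡ + r mod suc k)
                               (ℕ.≡ᵇ⇒≡ _ 0 remainder≡0) (≡-%ℕ (w - + z · + z) (suc k))))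

sqModᵇ-complete : ∀ w {m} → 1 ≤ m → SquareMod w m → T (sqModᵇ w m)
sqModᵇ-complete w {suc k} _ (z , w≡z²) =
  any⁺ _ (lose (∈-upTo⁺ (n%ℕd<d z (suc k))) (ℕ.≡⇒≡ᵇ _ 0 (∣⇒%ℕ≡0 _ (suc k) (divides-difference w≡r²))))
  where
  r = z %ℕ suc k
  w≡r² : w ≡ + r · + r mod suc k
  w≡r² = ≡-trans w≡z² (·-cong (≡-%ℕ z (suc k)) (≡-%ℕ z (suc k)))

euclid-ℤ : ∀ {p} → Prime p → ∀ y z → + p ∣ᶻ y · z → + p ∣ᶻ y ⊎ + p ∣ᶻ z
euclid-ℤ {p} p-prime y z p∣yz =
  Sum.map ∣ᵤ⇒∣ ∣ᵤ⇒∣ (euclidsLemma (∣ y ∣) (∣ z ∣) p-prime (subst (p ∣_) (ℤ.abs-* y z) (∣⇒∣ᵤ p∣yz)))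

∤-· : ∀ {p} → Prime p → ∀ {y z} → ¬ + p ∣ᶻ y → ¬ + p ∣ᶻ z → ¬ + p ∣ᶻ y · z
∤-· p-prime {y} {z} p∤y p∤z p∣yz = Sum.[ p∤y , p∤z ] (euclid-ℤ p-prime y z p∣yz)

prime∤⇒coprime : ∀ {p n} → Prime p → ¬ p ∣ n → Coprime p n
prime∤⇒coprime p-prime p∤n (d∣p , d∣n) with prime⇒irreducible p-prime d∣p
... | inj₁ d≡1 = d≡1
... | inj₂ refl = ⊥-elim (p∤n d∣n)

prime-positive : ∀ {q} → Prime q → 1 ≤ q
prime-positive {q} q-prime = ℕ.>-nonZero⁻¹ q {{prime⇒nonZero q-prime}}

∣-resp-≡ : ∀ {m x y} → x ≡ y mod m → + m ∣ᶻ y → + m ∣ᶻ x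
∣-resp-≡ x≡y m∣y = ≡0⇒∣ (≡-trans x≡y (∣⇒≡0 m∣y))

residue-injective : ∀ {m r r′} → r < m → r′ < m → + r ≡ + r′ mod m → r ≡ r′
residue-injective {m} {r} {r′} r<m r′<m (congruent m∣r-r′) =
  ℤ.+-injective (ℤ.i-j≡0⇒i≡j _ _ (ℤ.∣i∣≡0⇒i≡0 (∣-<⇒≡0 (∣⇒∣ᵤ m∣r-r′) distance<m)))
  where
  distance<m : ∣ + r - + r′ ∣ < m
  distance<m = subst (_< m) (cong ∣_∣ (sym (ℤ.[+m]-[+n]≡m⊖n r r′)))
                 (ℕ.≤-<-trans (ℤ.∣m⊝n∣≤m⊔n r r′) (ℕ.⊔-lub r<m r′<m))

invertible-mod-prime : ∀ {p} → Prime p → ∀ {s} → ¬ + p ∣ᶻ s → Σ ℤ λ t → t · s ≡ + 1 mod p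
invertible-mod-prime {p} p-prime {s} p∤s = t , ≡-trans (·-cong (≡-refl t) s≡r) tr≡1
  where
  instance _ = prime⇒nonZero p-prime
  r = s %ℕ p
  s≡r : s ≡ + r mod p
  s≡r = ≡-%ℕ s p
  p∤r : ¬ p ∣ r
  p∤r p∣r = p∤s (∣-resp-≡ s≡r (∣ᵤ⇒∣ p∣r))
  inverse = invertible (prime∤⇒coprime p-prime p∤r)
  t = proj₁ inverse
  tr≡1 : t · + r ≡ + 1 mod p
  tr≡1 = proj₂ inverse

square-cancel : ∀ {p} → Prime p → ∀ {y z} → ¬ + p ∣ᶻ y → SquareMod y p → SquareMod (y · z) p → SquareMod z p
square-cancel {p} p-prime {y} {z} p∤y (s , y≡s²) (w , yz≡w²) = w · t , z≡[wt]²
  where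
  p∤s : ¬ + p ∣ᶻ s
  p∤s p∣s = p∤y (∣-resp-≡ y≡s² (ℤ∣.∣m⇒∣m*n s p∣s))
  inverse = invertible-mod-prime p-prime p∤s
  t = proj₁ inverse
  ts≡1 : t · s ≡ + 1 mod p
  ts≡1 = proj₂ inverse
  z≡[wt]² : z ≡ (w · t) · (w · t) mod p
  z≡[wt]² = begin
    z                         ≡⟨ regroup₁ z ⟩
    (+ 1 · + 1) · z           ≈⟨ ·-cong (·-cong ts≡1 ts≡1) (≡-refl z) ⟨
    ((t · s) · (t · s)) · z   ≡⟨ regroup₂ t s z ⟩
    (t · t) · ((s · s) · z)   ≈⟨ ·-cong (≡-refl (t · t)) (·-cong y≡s² (≡-refl z)) ⟨
    (t · t) · (y · z)         ≈⟨ ·-cong (≡-refl (t · t)) yz≡w² ⟩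
    (t · t) · (w · w)         ≡⟨ regroup₃ t w ⟩
    (w · t) · (w · t)         ∎
    where
    open ≡-mod-Reasoning p
    regroup₁ : ∀ z → z ≡ (+ 1 · + 1) · z
    regroup₁ = solve-∀
    regroup₂ : ∀ t s z → ((t · s) · (t · s)) · z ≡ (t · t) · ((s · s) · z)
    regroup₂ = solve-∀
    regroup₃ : ∀ t w → (t · t) · (w · w) ≡ (w · t) · (w · t)
    regroup₃ = solve-∀

-- Squares among the units modulo an odd prime p = 2h + 1.  At least h of the 2h units
-- are squares, which forces the product of two non-squares to be a square.
module NonSquares (h : ℕ) (p-prime : Prime (suc (h ℕ.+ h))) where

  private
    p : ℕ
    p = suc (h ℕ.+ h)

  units : List ℕ
  units = range1 (h ℕ.+ h)

  isSquare : ℕ → Bool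
  isSquare r = sqModᵇ (+ r) p

  squares nonSquares : List ℕ
  squares = filterᵇ isSquare units
  nonSquares = filterᵇ (not ∘ isSquare) units

  reduce : ℤ → ℕ
  reduce w = w %ℕ p

  ≡-reduce : ∀ w → w ≡ + reduce w mod p
  ≡-reduce w = ≡-%ℕ w p

  ≡-of-reduce : ∀ {a b} → reduce a ≡ reduce b → a ≡ b mod p
  ≡-of-reduce {a} {b} eq = ≡-trans (≡-reduce a) (≡-trans (≡-reflexive (cong +_ eq)) (≡-sym (≡-reduce b)))

  unit-bound : ∀ {r} → r ∈ units → r < p
  unit-bound r∈ = s≤s (proj₂ (range1-bounds r∈))

  unit-∤ : ∀ {r} → r ∈ units → ¬ + p ∣ᶻ + r
  unit-∤ r∈ p∣r with range1-bounds r∈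
  ... | 1≤r , _ = ℕ.<⇒≢ 1≤r (sym (∣-<⇒≡0 (∣⇒∣ᵤ p∣r) (unit-bound r∈)))

  reduce-unit : ∀ {w} → ¬ + p ∣ᶻ w → reduce w ∈ units
  reduce-unit {w} p∤w = ∈-range1 (nonzero (reduce w) refl) (ℕ.≤-pred (n%ℕd<d w p))
    where
    nonzero : ∀ r → reduce w ≡ r → 1 ≤ r
    nonzero zero w%p≡0 = ⊥-elim (p∤w (≡0⇒∣ (subst (λ r → w ≡ + r mod p) w%p≡0 (≡-%ℕ w p))))
    nonzero (suc r) _ = s≤s z≤n

  -- At least h units are squares, since 1², …, h² are distinct modulo p.
  many-squares : h ≤ length squares
  many-squares = subst (_≤ length squares) (length-range1 h)
    (injection-length square (range1-unique h) injective into)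
    where
    square : ℕ → ℕ
    square r = reduce (+ r · + r)
    small : ∀ {r} → r ∈ range1 h → r ∈ units
    small r∈ = ∈-range1 (proj₁ (range1-bounds r∈)) (ℕ.≤-trans (proj₂ (range1-bounds r∈)) (ℕ.m≤m+n h h))
    injective : ∀ {a b} → a ∈ range1 h → b ∈ range1 h → square a ≡ square b → a ≡ b
    injective {a} {b} a∈ b∈ eq = Sum.[ equal , impossible ] (euclid-ℤ p-prime (+ a - + b) (+ a + + b) p∣[a-b][a+b])
      where
      a²≡b² : + a · + a ≡ + b · + b mod p
      a²≡b² = ≡-of-reduce eq
      p∣[a-b][a+b] : + p ∣ᶻ (+ a - + b) · (+ a + + b)
      p∣[a-b][a+b] = subst (+ p ∣ᶻ_) (difference-of-squares (+ a) (+ b)) (divides-difference a²≡b²)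
        where difference-of-squares : ∀ a b → a · a - b · b ≡ (a - b) · (a + b)
              difference-of-squares = solve-∀
      equal : + p ∣ᶻ + a - + b → a ≡ b
      equal p∣a-b = residue-injective (unit-bound (small a∈)) (unit-bound (small b∈)) (congruent p∣a-b)
      impossible : + p ∣ᶻ + a + + b → a ≡ b
      impossible p∣a+b = ⊥-elim (ℕ.<⇒≢ (ℕ.≤-trans (proj₁ (range1-bounds a∈)) (ℕ.m≤m+n a b))
        (sym (∣-<⇒≡0 (∣⇒∣ᵤ (subst (+ p ∣ᶻ_) (sym (ℤ.pos-+ a b)) p∣a+b))
                     (s≤s (ℕ.+-mono-≤ (proj₂ (range1-bounds a∈)) (proj₂ (range1-bounds b∈)))))))
    into : ∀ {r} → r ∈ range1 h → square r ∈ squares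
    into {r} r∈ = ∈-filter⁺ (T? ∘ isSquare) (reduce-unit (∤-· p-prime (unit-∤ (small r∈)) (unit-∤ (small r∈))))
                    (sqModᵇ-complete (+ square r) (s≤s z≤n) (+ r , ≡-sym (≡-reduce (+ r · + r))))

  squares-unique : Unique squares
  squares-unique = Unique.filter⁺ (T? ∘ isSquare) (range1-unique (h ℕ.+ h))

  square-member : ∀ {t} → t ∈ squares → SquareMod (+ t) p
  square-member t∈ = sqModᵇ-sound (+ _) (s≤s z≤n) (proj₂ (∈-filter⁻ (T? ∘ isSquare) {xs = units} t∈))

  -- Not all of y, z and y·z can be non-squares: otherwise r ↦ y·r maps z and the squares
  -- injectively to non-squares, so there are more non-squares than squares.
  no-three-non-squares : ∀ {y z} → ¬ + p ∣ᶻ y → ¬ + p ∣ᶻ z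
                       → ¬ SquareMod y p → ¬ SquareMod z p → ¬ SquareMod (y · z) p → ⊥
  no-three-non-squares {y} {z} p∤y p∤z y-non z-non yz-non = ℕ.<-irrefl refl (begin-strict
    length squares ℕ.+ length squares    <⟨ ℕ.+-monoʳ-< (length squares) more-non-squares ⟩
    length squares ℕ.+ length nonSquares ≡⟨ trans (length-filter-split isSquare units) (length-range1 (h ℕ.+ h)) ⟩
    h ℕ.+ h                              ≤⟨ ℕ.+-mono-≤ many-squares many-squares ⟩
    length squares ℕ.+ length squares    ∎)
    where
    open ≤-Reasoning
    z₀ = reduce z
    candidates : List ℕ
    candidates = z₀ ∷ squares
    candidate-unit : ∀ {t} → t ∈ candidates → t ∈ units
    candidate-unit (here refl) = reduce-unit p∤z
    candidate-unit (there t∈) = proj₁ (∈-filter⁻ (T? ∘ isSquare) {xs = units} t∈)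
    candidates-unique : Unique candidates
    candidates-unique = All.tabulate (λ { t∈ refl → z-non (square-resp (≡-sym (≡-reduce z)) (square-member t∈)) })
                        ∷ squares-unique
    multiply : ℕ → ℕ
    multiply t = reduce (y · + t)
    injective : ∀ {a b} → a ∈ candidates → b ∈ candidates → multiply a ≡ multiply b → a ≡ b
    injective {a} {b} a∈ b∈ eq = residue-injective (unit-bound (candidate-unit a∈)) (unit-bound (candidate-unit b∈))
      (congruent (Sum.[ ⊥-elim ∘ p∤y , id ] (euclid-ℤ p-prime y (+ a - + b) p∣y[a-b])))
      where
      ya≡yb : y · + a ≡ y · + b mod p
      ya≡yb = ≡-of-reduce eq
      p∣y[a-b] : + p ∣ᶻ y · (+ a - + b)
      p∣y[a-b] = subst (+ p ∣ᶻ_) (factor y (+ a) (+ b)) (divides-difference ya≡yb)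
        where factor : ∀ y a b → y · a - y · b ≡ y · (a - b)
              factor = solve-∀
    non-square : ∀ {t} → t ∈ candidates → ¬ SquareMod (y · + t) p
    non-square (here refl) yz₀-square = yz-non (square-resp (·-cong (≡-refl y) (≡-sym (≡-reduce z))) yz₀-square)
    non-square {t} (there t∈) yt-square = y-non (square-cancel p-prime (unit-∤ (candidate-unit (there t∈))) (square-member t∈)
                                                  (square-resp (≡-reflexive (ℤ.*-comm y (+ t))) yt-square))
    into : ∀ {t} → t ∈ candidates → multiply t ∈ nonSquares
    into {t} t∈ = ∈-filter⁺ (T? ∘ not ∘ isSquare) (reduce-unit (∤-· p-prime p∤y (unit-∤ (candidate-unit t∈))))
      (T-not (λ sq → non-square t∈ (square-resp (≡-sym (≡-reduce (y · + t))) (sqModᵇ-sound (+ multiply t) (s≤s z≤n) sq))))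
    more-non-squares : length squares < length nonSquares
    more-non-squares = injection-length multiply candidates-unique injective into

odd⇒2h+1 : ∀ {n} → ¬ 2 ∣ n → Σ ℕ λ h → n ≡ suc (h ℕ.+ h)
odd⇒2h+1 {zero} 2∤0 = ⊥-elim (2∤0 (ℕ._∣0 2))
odd⇒2h+1 {suc zero} _ = 0 , refl
odd⇒2h+1 {suc (suc n)} 2∤n+2 with odd⇒2h+1 {n} (λ 2∣n → 2∤n+2 (ℕ.∣m∣n⇒∣m+n (ℕ.∣-refl {2}) 2∣n))
... | h , refl = suc h , cong (suc ∘ suc) (sym (ℕ.+-suc h h))

β-· : ∀ {p} → Prime p → ¬ 2 ∣ p → ∀ {y z} → ¬ + p ∣ᶻ y → ¬ + p ∣ᶻ z → β (y · z) p ≡ (β y p xor β z p)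
β-· {p} p-prime p-odd {y} {z} p∤y p∤z with odd⇒2h+1 p-odd
... | h , refl = by-cases (sqModᵇ y p) (sqModᵇ z p) (sqModᵇ (y · z) p) refl refl refl
  where
  open NonSquares h p-prime using (no-three-non-squares)
  square : ∀ w → sqModᵇ w p ≡ true → SquareMod w p
  square w w-sq = sqModᵇ-sound w (s≤s z≤n) (subst T (sym w-sq) _)
  non-square : ∀ w → sqModᵇ w p ≡ false → ¬ SquareMod w p
  non-square w w-non w-sq = subst T w-non (sqModᵇ-complete w (s≤s z≤n) w-sq)
  by-cases : ∀ a b c → sqModᵇ y p ≡ a → sqModᵇ z p ≡ b → sqModᵇ (y · z) p ≡ c → not c ≡ (not a xor not b)
  by-cases true  true  true  _ _ _ = refl
  by-cases true  true  false y-sq z-sq yz-non = ⊥-elim (non-square (y · z) yz-non (square-· (square y y-sq) (square z z-sq)))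
  by-cases true  false true  y-sq z-non yz-sq = ⊥-elim (non-square z z-non (square-cancel p-prime p∤y (square y y-sq) (square (y · z) yz-sq)))
  by-cases true  false false _ _ _ = refl
  by-cases false true  true  y-non z-sq yz-sq = ⊥-elim (non-square y y-non
    (square-cancel p-prime p∤z (square z z-sq) (square-resp (≡-reflexive (ℤ.*-comm y z)) (square (y · z) yz-sq))))
  by-cases false true  false _ _ _ = refl
  by-cases false false true  _ _ _ = refl
  by-cases false false false y-non z-non yz-non =
    ⊥-elim (no-three-non-squares p∤y p∤z (non-square y y-non) (non-square z z-non) (non-square (y · z) yz-non))

module _ {A : Set} where

  ⊕-sum : (A → Bool) → List A → Bool
  ⊕-sum g = foldr (λ j acc → g j xor acc) false

  ⊕-sum-cong : ∀ {g g′ : A → Bool} → (∀ j → g j ≡ g′ j) → ∀ L → ⊕-sum g L ≡ ⊕-sum g′ L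
  ⊕-sum-cong g≗g′ [] = refl
  ⊕-sum-cong g≗g′ (j ∷ L) = cong₂ _xor_ (g≗g′ j) (⊕-sum-cong g≗g′ L)

  ⊕-sum-xor : ∀ (g g′ : A → Bool) L → ⊕-sum (λ j → g j xor g′ j) L ≡ (⊕-sum g L xor ⊕-sum g′ L)
  ⊕-sum-xor g g′ [] = refl
  ⊕-sum-xor g g′ (j ∷ L) = trans (cong ((g j xor g′ j) xor_) (⊕-sum-xor g g′ L))
                                 (interchange (g j) (g′ j) (⊕-sum g L) (⊕-sum g′ L))
    where
    open xor-∧-Solver
    interchange : ∀ a b c d → (a xor b) xor (c xor d) ≡ (a xor c) xor (b xor d)
    interchange = solve 4 (λ a b c d → (a :+ b) :+ (c :+ d) := (a :+ c) :+ (b :+ d)) refl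

  Π : (A → ℕ) → List A → ℕ
  Π f = foldr (λ j acc → f j * acc) 1

  Π-cong : ∀ {f g : A → ℕ} → (∀ j → f j ≡ g j) → ∀ L → Π f L ≡ Π g L
  Π-cong f≗g [] = refl
  Π-cong f≗g (j ∷ L) = cong₂ _*_ (f≗g j) (Π-cong f≗g L)

  Π-* : ∀ (f g : A → ℕ) L → Π f L * Π g L ≡ Π (λ j → f j * g j) L
  Π-* f g [] = refl
  Π-* f g (j ∷ L) = trans (ℕ-interchange (f j) (Π f L) (g j) (Π g L)) (cong (f j * g j *_) (Π-* f g L))

  Π-positive : ∀ {f : A → ℕ} → (∀ j → 1 ≤ f j) → ∀ L → 1 ≤ Π f L
  Π-positive f≥1 [] = s≤s z≤n
  Π-positive f≥1 (j ∷ L) = ℕ.*-mono-≤ (f≥1 j) (Π-positive f≥1 L)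

  Π-∣ : ∀ (f : A → ℕ) {L j} → j ∈ L → f j ∣ Π f L
  Π-∣ f {k ∷ L} (here refl) = ℕ.m∣m*n (Π f L)
  Π-∣ f {k ∷ L} (there j∈L) = ℕ.∣-trans (Π-∣ f j∈L) (ℕ.n∣m*n (f k))

  prime-∣-Π : ∀ {q} → Prime q → ∀ (f : A → ℕ) L → q ∣ Π f L → Σ A λ k → k ∈ L × q ∣ f k
  prime-∣-Π q-prime f [] q∣1 = ⊥-elim (¬prime[1] (subst Prime (ℕ.∣1⇒≡1 q∣1) q-prime))
  prime-∣-Π q-prime f (k ∷ L) q∣Π with euclidsLemma (f k) (Π f L) q-prime q∣Π
  ... | inj₁ q∣fk = k , here refl , q∣fk
  ... | inj₂ q∣rest with prime-∣-Π q-prime f L q∣rest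
  ... | k′ , k′∈L , q∣fk′ = k′ , there k′∈L , q∣fk′

squarefree-∣ : ∀ {n c} .{{_ : NonZero n}} → (∀ q → Prime q → ¬ q * q ∣ n)
             → (∀ q → Prime q → q ∣ n → q ∣ c) → n ∣ c
squarefree-∣ {n} {c} squarefree primes∣c =
  subst (_∣ c) (sym isFactorisation) (product-∣ factors factorsPrime
    (subst (λ m → ∀ q → Prime q → ¬ q * q ∣ m) isFactorisation squarefree)
    (subst (λ m → ∀ q → Prime q → q ∣ m → q ∣ c) isFactorisation primes∣c))
  where
  open PrimeFactorisation (factorise n)
  product-∣ : ∀ fs → All Prime fs → (∀ q → Prime q → ¬ q * q ∣ product fs)
            → (∀ q → Prime q → q ∣ product fs → q ∣ c) → product fs ∣ c
  product-∣ [] [] _ _ = ℕ.1∣ c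
  product-∣ (q ∷ fs) (q-prime ∷ primes) sqf div =
    coprime-∣-* (prime∤⇒coprime q-prime q∤rest) (div q q-prime (ℕ.m∣m*n (product fs)))
      (product-∣ fs primes (λ r r-prime r²∣ → sqf r r-prime (ℕ.∣-trans r²∣ (ℕ.n∣m*n q)))
                           (λ r r-prime r∣ → div r r-prime (ℕ.∣-trans r∣ (ℕ.n∣m*n q))))
    where
    q∤rest : ¬ q ∣ product fs
    q∤rest q∣rest = sqf q q-prime (ℕ.*-monoʳ-∣ q q∣rest)

β-Π : ∀ {A : Set} {q} → Prime q → ¬ 2 ∣ q → ∀ (f : A → ℕ) L → (∀ {j} → j ∈ L → ¬ + q ∣ᶻ + f j)
    → ∀ {w} → ¬ + q ∣ᶻ w → β (w · + Π f L) q ≡ (β w q xor ⊕-sum (λ j → β (+ f j) q) L)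
β-Π {q = q} q-prime q-odd f [] _ {w} _ = trans (cong (λ t → β t q) (ℤ.*-identityʳ w)) (sym (xor-identityʳ _))
β-Π {q = q} q-prime q-odd f (j ∷ L) q∤f {w} q∤w = begin
  β (w · + Π f (j ∷ L)) q                                   ≡⟨ cong (λ t → β t q) regroup ⟩
  β ((w · + f j) · + Π f L) q                               ≡⟨ β-Π q-prime q-odd f L (q∤f ∘ there) (∤-· q-prime q∤w q∤fj) ⟩
  β (w · + f j) q xor rest                                  ≡⟨ cong (_xor rest) (β-· q-prime q-odd q∤w q∤fj) ⟩
  (β w q xor β (+ f j) q) xor rest                          ≡⟨ xor-assoc (β w q) (β (+ f j) q) rest ⟩
  β w q xor ⊕-sum (λ k → β (+ f k) q) (j ∷ L)               ∎
  where
  open ≡-Reasoning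
  rest = ⊕-sum (λ k → β (+ f k) q) L
  q∤fj = q∤f (here refl)
  regroup : w · + (f j * Π f L) ≡ (w · + f j) · + Π f L
  regroup = trans (cong (w ·_) (ℤ.pos-* (f j) (Π f L))) (sym (ℤ.*-assoc w (+ f j) (+ Π f L)))

-- Divisors of a product of distinct primes p₀, …, p_{ω-1}, encoded by vectors x ∈ 𝔽₂^ω.
module Subproducts {ω : ℕ} (p : Fin ω → ℕ) (p-prime : ∀ i → Prime (p i))
                   (p-injective : ∀ {i j} → p i ≡ p j → i ≡ j) where

  factor : Bool → Fin ω → ℕ
  factor b j = if b then p j else 1

  selected : Vec Bool ω → Fin ω → ℕ
  selected x j = factor (lookup x j) j

  Ψ : Vec Bool ω → ℕ
  Ψ x = Π (selected x) (allFin ω)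

  p∣factor : ∀ {i j b} → p i ∣ factor b j → b ≡ true × i ≡ j
  p∣factor {i} {j} {false} pi∣1 = ⊥-elim (¬prime[1] (subst Prime (ℕ.∣1⇒≡1 pi∣1) (p-prime i)))
  p∣factor {i} {j} {true} pi∣pj with prime⇒irreducible (p-prime j) pi∣pj
  ... | inj₁ pi≡1 = ⊥-elim (¬prime[1] (subst Prime pi≡1 (p-prime i)))
  ... | inj₂ pi≡pj = refl , p-injective pi≡pj

  p∣Ψ : ∀ x {j} → lookup x j ≡ true → p j ∣ Ψ x
  p∣Ψ x {j} xj≡1 = subst (λ b → factor b j ∣ Ψ x) xj≡1 (Π-∣ (selected x) (∈-allFin j))

  p∣Ψ⇒ : ∀ x {j} → p j ∣ Ψ x → lookup x j ≡ true
  p∣Ψ⇒ x {j} pj∣Ψ with prime-∣-Π (p-prime j) (selected x) (allFin ω) pj∣Ψ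
  ... | k , _ , pj∣factor with p∣factor {b = lookup x k} pj∣factor
  ... | xk≡1 , refl = xk≡1

  Ψ-injective : ∀ {x y} → Ψ x ≡ Ψ y → x ≡ y
  Ψ-injective {x} {y} Ψx≡Ψy = trans (sym (Vec.tabulate∘lookup x))
    (trans (Vec.tabulate-cong same) (Vec.tabulate∘lookup y))
    where
    same : ∀ j → lookup x j ≡ lookup y j
    same j with lookup x j in xj | lookup y j in yj
    ... | true | true = refl
    ... | false | false = refl
    ... | true | false = sym (trans (sym yj) (p∣Ψ⇒ y (subst (p j ∣_) Ψx≡Ψy (p∣Ψ x xj))))
    ... | false | true = trans (sym xj) (p∣Ψ⇒ x (subst (p j ∣_) (sym Ψx≡Ψy) (p∣Ψ y yj)))

  Ψ-positive : ∀ x → 1 ≤ Ψ x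
  Ψ-positive x = Π-positive (λ j → factor-positive (lookup x j) j) (allFin ω)
    where
    factor-positive : ∀ b j → 1 ≤ factor b j
    factor-positive false j = s≤s z≤n
    factor-positive true j = prime-positive (p-prime j)

  Ψ-complement : ∀ x → Ψ x * Ψ (Vec.map not x) ≡ Π p (allFin ω)
  Ψ-complement x = trans (Π-* (selected x) (selected (Vec.map not x)) (allFin ω)) (Π-cong both (allFin ω))
    where
    both : ∀ j → selected x j * selected (Vec.map not x) j ≡ p j
    both j rewrite Vec.lookup-map j not x with lookup x j
    ... | true = ℕ.*-identityʳ (p j)
    ... | false = ℕ.*-identityˡ (p j)

  -- Distinct primes are coprime, so a factor is coprime to the product of the others.
  factor-coprime : ∀ x {j L} → j ∉ L → Coprime (selected x j) (Π (selected x) L)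
  factor-coprime x {j} {L} j∉L with lookup x j
  ... | false = 1-coprimeTo _
  ... | true = prime∤⇒coprime (p-prime j) pj∤rest
    where
    pj∤rest : ¬ p j ∣ Π (selected x) L
    pj∤rest pj∣rest with prime-∣-Π (p-prime j) (selected x) L pj∣rest
    ... | k , k∈L , pj∣factor with p∣factor {b = lookup x k} pj∣factor
    ... | _ , refl = j∉L k∈L

  Ψ-induction : (P : ℕ → Set) → P 1 → (∀ {m n} → Coprime m n → P m → P n → P (m * n))
              → ∀ x → (∀ j → lookup x j ≡ true → P (p j)) → P (Ψ x)
  Ψ-induction P P1 P* x P-selected = over (allFin ω) (Unique.allFin⁺ ω)
    where
    P-factor : ∀ j → P (selected x j)
    P-factor j with lookup x j in xj
    ... | true = P-selected j xj
    ... | false = P1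
    over : ∀ L → Unique L → P (Π (selected x) L)
    over [] _ = P1
    over (j ∷ L) (j∉L ∷ unique) = P* (factor-coprime x (λ j∈L → All.lookup j∉L j∈L refl)) (P-factor j) (over L unique)

  β-1 : ∀ i → β (+ 1) (p i) ≡ false
  β-1 i = cong not (Equivalence.to T-≡ (sqModᵇ-complete (+ 1) (prime-positive (p-prime i)) (+ 1 , ≡-refl (+ 1))))

  β-Ψ : ∀ x i → ¬ 2 ∣ p i → lookup x i ≡ false → ∀ {w} → ¬ + p i ∣ᶻ w
      → β (w · + Ψ x) (p i) ≡ (β w (p i) xor sumExcept i (λ j → α (p j) (p i) ∧ lookup x j))
  β-Ψ x i pi-odd xi≡0 {w} pi∤w =
    trans (β-Π (p-prime i) pi-odd (selected x) (allFin ω) pi∤selected pi∤w)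
          (cong (β w (p i) xor_) (⊕-sum-cong (λ j → term j (lookup x j) (unselected j)) (allFin ω)))
    where
    unselected : ∀ j → lookup x j ≡ true → j ≢ i
    unselected j xj≡1 refl with trans (sym xi≡0) xj≡1
    ... | ()
    pi∤selected : ∀ {j} → j ∈ allFin ω → ¬ + p i ∣ᶻ + selected x j
    pi∤selected {j} _ pi∣ with p∣factor {b = lookup x j} (∣⇒∣ᵤ pi∣)
    ... | xj≡1 , refl = unselected j xj≡1 refl
    term : ∀ j b → (b ≡ true → j ≢ i) → β (+ factor b j) (p i) ≡ (if j ≡ᶠᵇ i then false else α (p j) (p i) ∧ b)
    term j b j≢i with j ≡ᶠᵇ i in j≟i | b
    ... | true | true = ⊥-elim (j≢i refl (≡ᶠᵇ⇒≡ j≟i))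
    ... | true | false = β-1 i
    ... | false | true = sym (∧-identityʳ _)
    ... | false | false = trans (β-1 i) (sym (∧-zeroʳ _))

  square-Ψ⇒ : ∀ w y {j} → T (sqModᵇ w (Ψ y)) → lookup y j ≡ true → T (sqModᵇ w (p j))
  square-Ψ⇒ w y {j} square yj≡1 =
    sqModᵇ-complete w (prime-positive (p-prime j)) (square-mod-∣ (p∣Ψ y yj≡1) (sqModᵇ-sound w (Ψ-positive y) square))

  square-Ψ⇐ : ∀ w y → (∀ j → lookup y j ≡ true → T (sqModᵇ w (p j))) → T (sqModᵇ w (Ψ y))
  square-Ψ⇐ w y squares = sqModᵇ-complete w (Ψ-positive y)
    (Ψ-induction (SquareMod w) (square-mod-1 w) square-mod-* y (λ j yj≡1 → sqModᵇ-sound w (prime-positive (p-prime j)) (squares j yj≡1)))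

module Divisors (D : ℕ) (D≥1 : 1 ≤ D) (squarefree : ∀ q → Prime q → ¬ q * q ∣ D)
                {ω : ℕ} (p : Fin ω → ℕ) (p-prime : ∀ i → Prime (p i)) (p-injective : ∀ {i j} → p i ≡ p j → i ≡ j)
                (p∣D : ∀ i → p i ∣ D) (all-primes : ∀ q → Prime q → q ∣ D → ∃ λ i → p i ≡ q) where

  open Subproducts p p-prime p-injective

  Φ : ℕ → Vec Bool ω
  Φ a = tabulate (λ j → isYes (p j ∣? a))

  lookup-Φ : ∀ a j → lookup (Φ a) j ≡ isYes (p j ∣? a)
  lookup-Φ a j = Vec.lookup∘tabulate (λ k → isYes (p k ∣? a)) j

  Φ-sound : ∀ a j → lookup (Φ a) j ≡ true → p j ∣ a
  Φ-sound a j Φj≡1 = toWitness {a? = p j ∣? a} (Equivalence.from T-≡ (trans (sym (lookup-Φ a j)) Φj≡1))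

  Φ-complete : ∀ a j → p j ∣ a → lookup (Φ a) j ≡ true
  Φ-complete a j pj∣a = trans (lookup-Φ a j) (Equivalence.to T-≡ (fromWitness {a? = p j ∣? a} pj∣a))

  Ψ-∣ : ∀ x {m} → (∀ j → lookup x j ≡ true → p j ∣ m) → Ψ x ∣ m
  Ψ-∣ x {m} = Ψ-induction (_∣ m) (ℕ.1∣ m) coprime-∣-* x

  Ψ∘Φ : ∀ {a} → a ∣ D → Ψ (Φ a) ≡ a
  Ψ∘Φ {a} a∣D = ℕ.∣-antisym (Ψ-∣ (Φ a) (Φ-sound a)) a∣Ψ
    where
    instance
      a≢0 : NonZero a
      a≢0 = ℕ.≢-nonZero (λ { refl → ℕ.<⇒≢ D≥1 (sym (ℕ.0∣⇒≡0 a∣D)) })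
    a∣Ψ : a ∣ Ψ (Φ a)
    a∣Ψ = squarefree-∣ (λ q q-prime q²∣a → squarefree q q-prime (ℕ.∣-trans q²∣a a∣D))
      (λ q q-prime q∣a → listed q∣a (all-primes q q-prime (ℕ.∣-trans q∣a a∣D)))
      where
      listed : ∀ {q} → q ∣ a → ∃ (λ i → p i ≡ q) → q ∣ Ψ (Φ a)
      listed q∣a (i , refl) = p∣Ψ (Φ a) (Φ-complete a i q∣a)

  Π≡D : Π p (allFin ω) ≡ D
  Π≡D = trans (Π-cong (λ j → cong (λ b → factor b j) (sym (Φ-complete D j (p∣D j)))) (allFin ω)) (Ψ∘Φ ℕ.∣-refl)

  Ψ-complement-D : ∀ x → Ψ x * Ψ (Vec.map not x) ≡ D
  Ψ-complement-D x = trans (Ψ-complement x) Π≡D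

module Equations {ω : ℕ} (p : Fin ω → ℕ) (p-prime : ∀ i → Prime (p i))
                 (p-injective : ∀ {i j} → p i ≡ p j → i ≡ j) (p-odd : ∀ i → ¬ 2 ∣ p i)
                 (u v : ℤ) (p∤u : ∀ i → ¬ + p i ∣ᶻ u) (p∤v : ∀ i → ¬ + p i ∣ᶻ v) where

  open Subproducts p p-prime p-injective

  -- The i-th equation of 𝓕_D(u,v) at x, with b in place of x_i (as in in𝓕ᵇ).
  equation : Vec Bool ω → Fin ω → Bool → Bool
  equation x i b = not ( ( ((β u (p i) xor β v (p i)) xor sumExcept i (λ j → α (p j) (p i))) ∧ b
                           xor sumExcept i (λ j → α (p j) (p i) ∧ lookup x j) )
                         xor β u (p i) )

  sumExcept-complement : ∀ x i → sumExcept i (λ j → α (p j) (p i) ∧ lookup (Vec.map not x) j)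
                       ≡ (sumExcept i (λ j → α (p j) (p i)) xor sumExcept i (λ j → α (p j) (p i) ∧ lookup x j))
  sumExcept-complement x i = trans (⊕-sum-cong split (allFin ω)) (⊕-sum-xor (λ j → if j ≡ᶠᵇ i then false else α (p j) (p i))
                                                                     (λ j → if j ≡ᶠᵇ i then false else α (p j) (p i) ∧ lookup x j) (allFin ω))
    where
    complement : ∀ a b → a ∧ not b ≡ (a xor (a ∧ b))
    complement true b = refl
    complement false b = refl
    split : ∀ j → (if j ≡ᶠᵇ i then false else α (p j) (p i) ∧ lookup (Vec.map not x) j)
                ≡ ((if j ≡ᶠᵇ i then false else α (p j) (p i)) xor (if j ≡ᶠᵇ i then false else α (p j) (p i) ∧ lookup x j))
    split j rewrite Vec.lookup-map j not x with j ≡ᶠᵇ i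
    ... | true = refl
    ... | false = complement (α (p j) (p i)) (lookup x j)

  equation-0 : ∀ x i → lookup x i ≡ false → equation x i (lookup x i) ≡ sqModᵇ (u · + Ψ x) (p i)
  equation-0 x i xi≡0 = begin
    equation x i (lookup x i)                     ≡⟨ cong (equation x i) xi≡0 ⟩
    equation x i false                            ≡⟨ cong not (drop (coefficient) S (β u (p i))) ⟩
    not (β u (p i) xor S)                         ≡⟨ cong not (β-Ψ x i (p-odd i) xi≡0 (p∤u i)) ⟨
    not (β (u · + Ψ x) (p i))                     ≡⟨ not-involutive _ ⟩
    sqModᵇ (u · + Ψ x) (p i)                      ∎
    where
    open ≡-Reasoning
    open xor-∧-Solver
    coefficient = (β u (p i) xor β v (p i)) xor sumExcept i (λ j → α (p j) (p i))
    S = sumExcept i (λ j → α (p j) (p i) ∧ lookup x j)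
    drop : ∀ c S bu → ((c ∧ false) xor S) xor bu ≡ bu xor S
    drop = solve 3 (λ c S bu → (c :* con false :+ S) :+ bu := bu :+ S) refl

  equation-1 : ∀ x i → lookup x i ≡ true → equation x i (lookup x i) ≡ sqModᵇ (v · + Ψ (Vec.map not x)) (p i)
  equation-1 x i xi≡1 = begin
    equation x i (lookup x i)                     ≡⟨ cong (equation x i) xi≡1 ⟩
    equation x i true                             ≡⟨ cong not (keep (β u (p i)) (β v (p i)) A S) ⟩
    not (β v (p i) xor (A xor S))                 ≡⟨ cong (λ t → not (β v (p i) xor t)) (sumExcept-complement x i) ⟨
    not (β v (p i) xor S̄)                         ≡⟨ cong not (β-Ψ (Vec.map not x) i (p-odd i) x̄i≡0 (p∤v i)) ⟨
    not (β (v · + Ψ (Vec.map not x)) (p i))       ≡⟨ not-involutive _ ⟩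
    sqModᵇ (v · + Ψ (Vec.map not x)) (p i)        ∎
    where
    open ≡-Reasoning
    open xor-∧-Solver
    A = sumExcept i (λ j → α (p j) (p i))
    S = sumExcept i (λ j → α (p j) (p i) ∧ lookup x j)
    S̄ = sumExcept i (λ j → α (p j) (p i) ∧ lookup (Vec.map not x) j)
    x̄i≡0 : lookup (Vec.map not x) i ≡ false
    x̄i≡0 = trans (Vec.lookup-map i not x) (cong not xi≡1)
    keep : ∀ bu bv A S → (((bu xor bv) xor A) ∧ true xor S) xor bu ≡ bv xor (A xor S)
    keep = solve 4 (λ bu bv A S → (((bu :+ bv) :+ A) :* con true :+ S) :+ bu := bv :+ (A :+ S)) refl

  local-squares : Vec Bool ω → Bool
  local-squares x = sqModᵇ (u · + Ψ x) (Ψ (Vec.map not x)) ∧ sqModᵇ (v · + Ψ (Vec.map not x)) (Ψ x)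

  local-global : ∀ x → local-squares x ≡ in𝓕ᵇ p u v x
  local-global x = T-ext local⇒equations equations⇒local
    where
    x̄ = Vec.map not x
    lookup-x̄ : ∀ j → lookup x̄ j ≡ not (lookup x j)
    lookup-x̄ j = Vec.lookup-map j not x
    local⇒equations : T (local-squares x) → T (in𝓕ᵇ p u v x)
    local⇒equations both = all⁻ (λ i → equation x i (lookup x i)) {xs = allFin ω} (All.tabulate (λ {i} _ → holds i))
      where
      ua-square = proj₁ (Equivalence.to T-∧ both)
      vb-square = proj₂ (Equivalence.to T-∧ both)
      holds : ∀ i → T (equation x i (lookup x i))
      holds i with false-or-true (lookup x i)
      ... | inj₁ xi≡0 = subst T (sym (equation-0 x i xi≡0))
                          (square-Ψ⇒ (u · + Ψ x) x̄ ua-square (trans (lookup-x̄ i) (cong not xi≡0)))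
      ... | inj₂ xi≡1 = subst T (sym (equation-1 x i xi≡1)) (square-Ψ⇒ (v · + Ψ x̄) x vb-square xi≡1)
    equations⇒local : T (in𝓕ᵇ p u v x) → T (local-squares x)
    equations⇒local in𝓕 = Equivalence.from T-∧ (ua-square , vb-square)
      where
      holds : ∀ i → T (equation x i (lookup x i))
      holds i = All.lookup (all⁺ (λ i → equation x i (lookup x i)) (allFin ω) in𝓕) (∈-allFin i)
      ua-square = square-Ψ⇐ (u · + Ψ x) x̄ (λ j x̄j≡1 →
        let xj≡0 = not-injective (trans (sym (lookup-x̄ j)) x̄j≡1) in subst T (equation-0 x j xj≡0) (holds j))
      vb-square = square-Ψ⇐ (v · + Ψ x̄) x (λ j xj≡1 → subst T (equation-1 x j xj≡1) (holds j))

module Factorisations (D : ℕ) (D≥1 : 1 ≤ D) (squarefree : ∀ q → Prime q → ¬ q * q ∣ D)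
                      {ω : ℕ} (p : Fin ω → ℕ) (p-prime : ∀ i → Prime (p i))
                      (p-injective : ∀ {i j} → p i ≡ p j → i ≡ j) (p-odd : ∀ i → ¬ 2 ∣ p i)
                      (p∣D : ∀ i → p i ∣ D) (all-primes : ∀ q → Prime q → q ∣ D → ∃ λ i → p i ≡ q)
                      (u v : ℤ) (p∤u : ∀ i → ¬ + p i ∣ᶻ u) (p∤v : ∀ i → ¬ + p i ∣ᶻ v) where

  open Subproducts p p-prime p-injective
  open Divisors D D≥1 squarefree p p-prime p-injective p∣D all-primes
  open Equations p p-prime p-injective p-odd u v p∤u p∤v

  counted : ℕ × ℕ → Bool
  counted (a , b) = ((a * b) ≡ᵇ D) ∧ (sqModᵇ (u · + a) b ∧ sqModᵇ (v · + b) a)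

  factorisation : Vec Bool ω → ℕ × ℕ
  factorisation x = Ψ x , Ψ (Vec.map not x)

  factorisations : List (ℕ × ℕ)
  factorisations = map factorisation (allVecs ω)

  factorisations-unique : Unique factorisations
  factorisations-unique = Unique.map⁺ (Ψ-injective ∘ cong proj₁) (allVecs-unique ω)

  factorisation∈pairs : ∀ {z} → z ∈ factorisations → T (counted z) → z ∈ pairsUpTo D
  factorisation∈pairs z∈ _ with ∈-map⁻ factorisation z∈
  ... | x , _ , refl = ∈-pairsUpTo (Ψ-positive x) (ℕ.∣⇒≤ (ℕ.divides (Ψ (Vec.map not x)) D≡Ψx̄·Ψx))
                                   (Ψ-positive (Vec.map not x)) (ℕ.∣⇒≤ (ℕ.divides (Ψ x) (sym (Ψ-complement-D x))))
    where
    instance _ = ℕ.>-nonZero D≥1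
    D≡Ψx̄·Ψx : D ≡ Ψ (Vec.map not x) * Ψ x
    D≡Ψx̄·Ψx = trans (sym (Ψ-complement-D x)) (ℕ.*-comm (Ψ x) _)

  counted∈factorisations : ∀ {z} → z ∈ pairsUpTo D → T (counted z) → z ∈ factorisations
  counted∈factorisations {a , b} _ counted-ab =
    subst (_∈ factorisations) (cong₂ _,_ Ψx≡a Ψx̄≡b) (∈-map⁺ factorisation (∈-allVecs x))
    where
    ab≡D : a * b ≡ D
    ab≡D = ℕ.≡ᵇ⇒≡ (a * b) D (proj₁ (Equivalence.to T-∧ counted-ab))
    x = Φ a
    Ψx≡a : Ψ x ≡ a
    Ψx≡a = Ψ∘Φ (ℕ.divides b (trans (sym ab≡D) (ℕ.*-comm a b)))
    instance
      a≢0 : NonZero a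
      a≢0 = ℕ.≢-nonZero (λ { refl → ℕ.<⇒≢ D≥1 ab≡D })
    Ψx̄≡b : Ψ (Vec.map not x) ≡ b
    Ψx̄≡b = ℕ.*-cancelˡ-≡ _ _ a (trans (cong (_* Ψ (Vec.map not x)) (sym Ψx≡a)) (trans (Ψ-complement-D x) (sym ab≡D)))

  counted-factorisation : ∀ x → counted (factorisation x) ≡ in𝓕ᵇ p u v x
  counted-factorisation x =
    trans (cong (_∧ local-squares x) (Equivalence.to T-≡ (ℕ.≡⇒≡ᵇ _ D (Ψ-complement-D x)))) (local-global x)

  𝓔≡#𝓕 : 𝓔 D u v ≡ #𝓕 p u v
  𝓔≡#𝓕 = begin
    𝓔 D u v                                  ≡⟨ countᵇ-unique counted (pairsUpTo-unique D) factorisations-unique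
                                                  counted∈factorisations factorisation∈pairs ⟩
    countᵇ counted factorisations             ≡⟨ countᵇ-map factorisation counted (allVecs ω) ⟩
    countᵇ (counted ∘ factorisation) (allVecs ω) ≡⟨ countᵇ-cong counted-factorisation (allVecs ω) ⟩
    #𝓕 p u v                                  ∎
    where open ≡-Reasoning


increasing⇒injective : ∀ {n} (f : Fin n → ℕ) → (∀ i j → i Fin.< j → f i < f j) → ∀ {i j} → f i ≡ f j → i ≡ j
increasing⇒injective f increasing {i} {j} fi≡fj with Finₚ.<-cmp i j
... | tri< i<j _ _ = ⊥-elim (ℕ.<-irrefl fi≡fj (increasing i j i<j))
... | tri≈ _ i≡j _ = i≡j
... | tri> _ _ j<i = ⊥-elim (ℕ.<-irrefl (sym fi≡fj) (increasing j i j<i))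

mainTheorem6 : (D : ℕ) → 1 ≤ D → ¬ (2 ∣ D) → (∀ q → Prime q → ¬ (q * q ∣ D))
    → (ω : ℕ) (p : Fin ω → ℕ)
    → (∀ i j → i Fin.< j → p i < p j)
    → (∀ i → Prime (p i)) → (∀ i → p i ∣ D)
    → (∀ q → Prime q → q ∣ D → ∃ λ i → p i ≡ q)
    → (u v : ℤ) → Coprime ∣ u ∣ D → Coprime ∣ v ∣ D
    → 𝓔 D u v ≡ #𝓕 p u v
mainTheorem6 D D≥1 D-odd squarefree ω p p-increasing p-prime p∣D all-primes u v u-coprime v-coprime =
  Factorisations.𝓔≡#𝓕 D D≥1 squarefree p p-prime (increasing⇒injective p p-increasing) p-odd p∣D all-primes
                       u v (coprime⇒∤ u-coprime) (coprime⇒∤ v-coprime)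
  where
  p-odd : ∀ i → ¬ 2 ∣ p i
  p-odd i 2∣pi = D-odd (ℕ.∣-trans 2∣pi (p∣D i))
  coprime⇒∤ : ∀ {w} → Coprime ∣ w ∣ D → ∀ i → ¬ + p i ∣ᶻ w
  coprime⇒∤ coprime i pi∣w = ¬prime[1] (subst Prime (coprime (∣⇒∣ᵤ pi∣w , p∣D i)) (p-prime i))
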